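{- Let $v\in a_{k,l}(n)$ be of type $(\alpha_1,\dots,\alpha_k;\beta_1,\dots,\beta_l)$ and put $\beta=\sum_{i=1}^l\beta_i$. Then there exists $w=w_1\cdots w_n\in a_{k,\beta}(n)$ (a word in $t_1,\dots,t_k,u_1,\dots,u_\beta$) such that: (1) no $u$-letter occurs more than once in $w$; (2) for every shuffle $A\in I(k,l)$ there is a shuffle $A'\in I(k,\beta)$ such that, if $P^*_v$ is the dual-$A$-RSK insertion tableau of $v$ and $P^*_w$ is the dual-$A'$-RSK insertion tableau of $w$, then $P^*_w$ is identical to $P^*_v$ except that, for every $i\le n$, the entry coming from the letter $v_i$ is replaced by $w_i$. Consequently $\mathrm{sh}(P^*_v)=\mathrm{sh}(P^*_w)$.
   Context: For integers $k,m\ge0$, let $t_1,\dots,t_k,u_1,\dots,u_m$ be distinct symbols ("$t$-letters" and "$u$-letters"); a shuffle is a total order $<_A$ on them with $t_1<_A\cdots<_A t_k$ and $u_1<_A\cdots<_A u_m$, and $I(k,m)$ is the set of shuffles; $a_{k,m}(n)$ is the set of words of length $n$ in these letters. A word $v\in a_{k,l}(n)$ has type $(\alpha_1,\dots,\alpha_k;\beta_1,\dots,\beta_l)$ if it is a rearrangement of $t_1^{\alpha_1}\cdots t_k^{\alpha_k}u_1^{\beta_1}\cdots u_l^{\beta_l}$. $c(i,j)$ is the cell in row $i$, column $j$ (English convention). The dual-$A$-RSK insertion of a letter $x$ proceeds in steps: initially $x$ is inserted into row 1 if a $t$-letter, into column 1 if a $u$-letter. Inserting a $t$-letter $y$ into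 row $r$: $y$ bumps the leftmost entry of row $r$ strictly $A$-greater than $y$, or if none, is placed in a new cell at the end of row $r$. Inserting a $u$-letter $y$ into column $c$: $y$ bumps the topmost entry of column $c$ that is $A$-greater than or equal to $y$, or if none, is placed in a new cell at the bottom of column $c$. An entry bumped from $c(i,j)$ is next inserted into row $i+1$ if a $t$-letter, into column $j+1$ if a $u$-letter; insertion ends when a new cell is created. The insertion tableau of a word is obtained by inserting its letters successively into the empty tableau; each letter occurrence of the word is tracked through the insertion, so each entry of the insertion tableau comes from a specific position $i$ of the word. -}

module Defs where

open import Data.Nat using (ℕ; zero; suc; _+_; _<_; _≤_; _≤?_; _<?_)
open import Data.Fin using (Fin) renaming (_<_ to _<ᶠ_)
open import Data.Fin.Properties using () renaming (_≟_ to _≟ᶠ_)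
open import Data.List using (List; []; _∷_; _++_; [_]; map; length)
open import Data.Vec using (Vec; lookup; zip; allFin; toList; sum)
import Data.Vec as V
open import Data.Maybe using (Maybe; just; nothing)
open import Data.Product using (_×_; _,_; proj₁; proj₂; Σ)
open import Relation.Binary.PropositionalEquality using (_≡_; refl; cong)
open import Relation.Nullary using (Dec; yes; no)

-- Letters t_1..t_k (t i) and u_1..u_m (u j), indices 0-based via Fin.

data Letter (k m : ℕ) : Set where
  t : Fin k → Letter k m
  u : Fin m → Letter k m

_≟L_ : ∀ {k m} (x y : Letter k m) → Dec (x ≡ y)
t i ≟L t j with i ≟ᶠ j
... | yes refl = yes refl
... | no ¬p = no λ { refl → ¬p refl }
t i ≟L u j = no λ ()
u i ≟L t j = no λ ()
u i ≟L u j with i ≟ᶠ j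
... | yes refl = yes refl
... | no ¬p = no λ { refl → ¬p refl }

Word : ℕ → ℕ → ℕ → Set
Word k m n = Vec (Letter k m) n

countL : ∀ {k m n} → Letter k m → Word k m n → ℕ
countL x V.[] = 0
countL x (y V.∷ w) with x ≟L y
... | yes _ = suc (countL x w)
... | no _ = countL x w

HasType : ∀ {k l n} → Word k l n → Vec ℕ k → Vec ℕ l → Set
HasType {k} {l} v α β =
  ((i : Fin k) → countL (t i) v ≡ lookup α i) × ((j : Fin l) → countL (u j) v ≡ lookup β j)

-- Shuffles I(k,m): total orders on the letters extending t_1<..<t_k and
-- u_1<..<u_m, represented by an injective rank function into ℕ
-- (x <_A y  iff  rank x < rank y).

record Shuffle (k m : ℕ) : Set where
  field
    rank : Letter k m → ℕ
    rank-injective : ∀ x y → rank x ≡ rank y → x ≡ y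
    t-increasing : ∀ i j → i <ᶠ j → rank (t i) < rank (t j)
    u-increasing : ∀ i j → i <ᶠ j → rank (u i) < rank (u j)

open Shuffle public

-- Tableaux with tracked entries: an entry is a letter together with the
-- position (in the word) of the letter occurrence it comes from.
-- A tableau is the list of its rows (top to bottom), rows left to right,
-- 0-based indices.

Entry : ℕ → ℕ → ℕ → Set
Entry k m n = Letter k m × Fin n

Tableau : ℕ → ℕ → ℕ → Set
Tableau k m n = List (List (Entry k m n))

shape : ∀ {k m n} → Tableau k m n → List ℕ
shape = map length

relabel : ∀ {k m m' n} → Word k m' n → Tableau k m n → Tableau k m' n
relabel w = map (map (λ e → lookup w (proj₂ e) , proj₂ e))

at : ∀ {a} {X : Set a} → List X → ℕ → Maybe X
at [] _ = nothing
at (x ∷ xs) zero = just x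
at (x ∷ xs) (suc c) = at xs c

setAt : ∀ {a} {X : Set a} → List X → ℕ → X → List X
setAt [] _ _ = []
setAt (x ∷ xs) zero y = y ∷ xs
setAt (x ∷ xs) (suc c) y = x ∷ setAt xs c y

module _ {k m n : ℕ} (A : Shuffle k m) where

  private
    E = Entry k m n
    T = Tableau k m n
    rk : E → ℕ
    rk e = rank A (proj₁ e)

  bumpRow : E → List E → ℕ → List E × Maybe (E × ℕ)
  bumpRow y [] j = [ y ] , nothing
  bumpRow y (e ∷ es) j with rk y <? rk e
  ... | yes _ = y ∷ es , just (e , j)
  ... | no _ = let r = bumpRow y es (suc j) in e ∷ proj₁ r , proj₂ r

  rowStep : ℕ → E → T → T × Maybe (E × ℕ)
  rowStep _ y [] = [ y ] ∷ [] , nothing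
  rowStep zero y (row ∷ P) = let r = bumpRow y row 0 in proj₁ r ∷ P , proj₂ r
  rowStep (suc r) y (row ∷ P) = let q = rowStep r y P in row ∷ proj₁ q , proj₂ q

  colStep : ℕ → E → T → ℕ → T × Maybe (E × ℕ)
  colStep c y [] i = [ y ] ∷ [] , nothing
  colStep c y (row ∷ P) i with at row c
  ... | nothing = (row ++ [ y ]) ∷ P , nothing
  ... | just e with rk y ≤? rk e
  ...   | yes _ = setAt row c y ∷ P , just (e , i)
  ...   | no _ = let q = colStep c y P (suc i) in row ∷ proj₁ q , proj₂ q

data Target : Set where
  row : ℕ → Target
  col : ℕ → Target

next : ∀ {k m n} → Entry k m n → ℕ → ℕ → Target
next (t _ , _) i j = row (suc i)
next (u _ , _) i j = col (suc j)

start : ∀ {k m n} → Entry k m n → Target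
start (t _ , _) = row 0
start (u _ , _) = col 0

data InsertAt {k m n : ℕ} (A : Shuffle k m) :
    Target → Entry k m n → Tableau k m n → Tableau k m n → Set where
  row-end : ∀ {r y P P'} → rowStep A r y P ≡ (P' , nothing) →
            InsertAt A (row r) y P P'
  row-bump : ∀ {r y P P' e j P''} → rowStep A r y P ≡ (P' , just (e , j)) →
             InsertAt A (next e r j) e P' P'' → InsertAt A (row r) y P P''
  col-end : ∀ {c y P P'} → colStep A c y P 0 ≡ (P' , nothing) →
            InsertAt A (col c) y P P'
  col-bump : ∀ {c y P P' e i P''} → colStep A c y P 0 ≡ (P' , just (e , i)) →
             InsertAt A (next e i c) e P' P'' → InsertAt A (col c) y P P''

data Run {k m n : ℕ} (A : Shuffle k m) :
    Tableau k m n → List (Entry k m n) → Tableau k m n → Set where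
  done : ∀ {P} → Run A P [] P
  step : ∀ {P P' P'' e es} → InsertAt A (start e) e P P' → Run A P' es P'' →
         Run A P (e ∷ es) P''

occurrences : ∀ {k m n} → Word k m n → List (Entry k m n)
occurrences {n = n} v = toList (zip v (allFin n))

InsTab : ∀ {k m n} → Shuffle k m → Word k m n → Tableau k m n → Set
InsTab A v P = Run A [] (occurrences v) P

{-# OPTIONS --safe #-}
module Submission where

-- Standardise the u-letters of v: the occurrences of u_j become distinct letters of a block
-- reserved for j, later occurrences getting smaller letters, and A' orders each block in this
-- way at the place of u_j in A.  Dual RSK insertion of v under A and of w under A' then make
-- the same comparisons at every step.  A row insertion compares a t-letter, which A' ranks
-- against every letter as A does, and a column insertion of u_j only meets earlier occurrences
-- of u_j, because the occurrences of one u-letter always lie in distinct columns, the earlier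
-- ones further right.  This strip order and the row-weak, column-strict shape of the tableau
-- are preserved by every bump.  They also give termination: each bump either strictly raises
-- the A-rank of the moving entry, or it moves on to an earlier occurrence of the same u-letter.

open import Defs
open import Data.Empty using (⊥; ⊥-elim)
open import Data.Fin as Fin using (Fin; zero; suc; toℕ; fromℕ<; splitAt; _↑ˡ_; _↑ʳ_)
  renaming (_<_ to _<ᶠ_; _≤_ to _≤ᶠ_)
open import Data.Fin.Properties as Finₚ
  using (toℕ-injective; toℕ-fromℕ<; toℕ<n; toℕ-↑ˡ; toℕ-↑ʳ; ↑ˡ-injective; ↑ʳ-injective;
         splitAt-↑ˡ; splitAt-↑ʳ; splitAt⁻¹-↑ˡ; splitAt⁻¹-↑ʳ)
open import Data.List using (List; []; _∷_; _++_; [_]; map; length)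
open import Data.List.Properties using (map-++; map-∘; map-cong; length-map)
open import Data.List.Relation.Unary.All using (All; []; _∷_)
open import Data.Maybe as Maybe using (Maybe; just; nothing)
open import Data.Maybe.Properties using (just-injective)
open import Data.Nat using (ℕ; zero; suc; _+_; _*_; _∸_; _<_; _≤_; _⊔_; z≤n; s≤s; _<?_; _≤?_)
open import Data.Nat.Induction using (<-wellFounded)
open import Data.Nat.Properties
open import Data.Product using (Σ; ∃-syntax; _×_; _,_; proj₁; proj₂; map₁; map₂)
open import Data.Product.Properties using (≡-dec)
open import Data.Product.Relation.Binary.Lex.Strict using (×-Lex; ×-wellFounded)
open import Data.Sum using (_⊎_; inj₁; inj₂)
open import Data.Unit using (⊤; tt)
open import Data.Vec as Vec using (Vec; lookup; toList; zip; allFin; tabulate; sum)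
open import Data.Vec.Properties
  using (lookup-zip; lookup-allFin; lookup∘tabulate; tabulate∘lookup; tabulate-cong; tabulate-∘; toList-map)
open import Data.Vec.Relation.Unary.All.Properties using (toList⁺; lookup⁻)
open import Function using (_∘_; _⇔_; mk⇔; Equivalence; case_of_)
open import Induction.WellFounded using (Acc; acc; WellFounded)
open import Relation.Binary.Definitions using (tri<; tri≈; tri>)
open import Relation.Binary.PropositionalEquality
  using (_≡_; _≢_; refl; sym; trans; cong; subst; subst₂; module ≡-Reasoning)
open import Relation.Nullary using (yes; no; contradiction)

below≢ : ∀ {i j : ℕ} → (suc i , j) ≢ (i , j)
below≢ = 1+n≢n ∘ cong proj₁

right≢ : ∀ {i j : ℕ} → (i , suc j) ≢ (i , j)
right≢ = 1+n≢n ∘ cong proj₂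

module _ {X : Set} where

  cell : List (List X) → ℕ → ℕ → Maybe X
  cell []      _       _ = nothing
  cell (r ∷ Q) zero    j = at r j
  cell (r ∷ Q) (suc i) j = cell Q i j

  AllCells : (X → Set) → List (List X) → Set
  AllCells P Q = ∀ {i j x} → cell Q i j ≡ just x → P x

  record CellUpdate (Q Q' : List (List X)) (i j : ℕ) (y : X) : Set where
    field
      updated   : cell Q' i j ≡ just y
      unchanged : ∀ {i' j'} → (i' , j') ≢ (i , j) → cell Q' i' j' ≡ cell Q i' j'

  open CellUpdate public

  at-setAt : ∀ (xs : List X) {c y e} → at xs c ≡ just e → at (setAt xs c y) c ≡ just y
  at-setAt (x ∷ xs) {zero}  _  = refl
  at-setAt (x ∷ xs) {suc c} eq = at-setAt xs eq

  at-setAt-≢ : ∀ (xs : List X) {c c' y} → c' ≢ c → at (setAt xs c y) c' ≡ at xs c'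
  at-setAt-≢ []       _ = refl
  at-setAt-≢ (x ∷ xs) {zero}  {zero}   c'≢c = contradiction refl c'≢c
  at-setAt-≢ (x ∷ xs) {zero}  {suc c'} _    = refl
  at-setAt-≢ (x ∷ xs) {suc c} {zero}   _    = refl
  at-setAt-≢ (x ∷ xs) {suc c} {suc c'} c'≢c = at-setAt-≢ xs (c'≢c ∘ cong suc)

  at-∷ʳ : ∀ (xs : List X) {y} → at (xs ++ [ y ]) (length xs) ≡ just y
  at-∷ʳ []       = refl
  at-∷ʳ (x ∷ xs) = at-∷ʳ xs

  at-∷ʳ-≢ : ∀ (xs : List X) {y c} → c ≢ length xs → at (xs ++ [ y ]) c ≡ at xs c
  at-∷ʳ-≢ []       {c = zero}  c≢0 = contradiction refl c≢0
  at-∷ʳ-≢ []       {c = suc c} _   = refl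
  at-∷ʳ-≢ (x ∷ xs) {c = zero}  _   = refl
  at-∷ʳ-≢ (x ∷ xs) {c = suc c} c≢n = at-∷ʳ-≢ xs (c≢n ∘ cong suc)

  at≡nothing⇒length≤ : ∀ (xs : List X) {c} → at xs c ≡ nothing → length xs ≤ c
  at≡nothing⇒length≤ []       _          = z≤n
  at≡nothing⇒length≤ (x ∷ xs) {suc c} eq = s≤s (at≡nothing⇒length≤ xs eq)

  length≤⇒at≡nothing : ∀ (xs : List X) {c} → length xs ≤ c → at xs c ≡ nothing
  length≤⇒at≡nothing []       _         = refl
  length≤⇒at≡nothing (x ∷ xs) (s≤s n≤c) = length≤⇒at≡nothing xs n≤c

  cell≡just⇒<length : ∀ (Q : List (List X)) {i j x} → cell Q i j ≡ just x → i < length Q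
  cell≡just⇒<length (r ∷ Q) {zero}  _  = s≤s z≤n
  cell≡just⇒<length (r ∷ Q) {suc i} eq = s≤s (cell≡just⇒<length Q eq)

  cell≡nothing-mono : ∀ (Q : List (List X)) {i j j'} → j ≤ j' →
                      cell Q i j ≡ nothing → cell Q i j' ≡ nothing
  cell≡nothing-mono []      _ _ = refl
  cell≡nothing-mono (r ∷ Q) {zero}  j≤j' eq =
    length≤⇒at≡nothing r (≤-trans (at≡nothing⇒length≤ r eq) j≤j')
  cell≡nothing-mono (r ∷ Q) {suc i} j≤j' eq = cell≡nothing-mono Q j≤j' eq

  cellUpdate-setAt : ∀ (r : List X) Q {c y e} → at r c ≡ just e →
                     CellUpdate (r ∷ Q) (setAt r c y ∷ Q) 0 c y
  cellUpdate-setAt r Q eq = record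
    { updated   = at-setAt r eq
    ; unchanged = λ { {zero} ne → at-setAt-≢ r (ne ∘ cong (0 ,_)) ; {suc _} _ → refl } }

  cellUpdate-append : ∀ (r : List X) Q {y} → CellUpdate (r ∷ Q) ((r ++ [ y ]) ∷ Q) 0 (length r) y
  cellUpdate-append r Q = record
    { updated   = at-∷ʳ r
    ; unchanged = λ { {zero} ne → at-∷ʳ-≢ r (ne ∘ cong (0 ,_)) ; {suc _} _ → refl } }

  cellUpdate-newRow : ∀ {y} → CellUpdate [] ([ y ] ∷ []) 0 0 y
  cellUpdate-newRow = record
    { updated   = refl
    ; unchanged = λ { {zero} {zero} ne → contradiction refl ne ; {zero} {suc _} _ → refl ; {suc _} _ → refl } }

  cellUpdate-∷ : ∀ r {Q Q' : List (List X)} {i j y} → CellUpdate Q Q' i j y →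
                 CellUpdate (r ∷ Q) (r ∷ Q') (suc i) j y
  cellUpdate-∷ r upd = record
    { updated   = updated upd
    ; unchanged = λ { {zero} _ → refl ; {suc _} ne → unchanged upd (ne ∘ cong (map₁ suc)) } }

  cellUpdate-cases : ∀ {Q Q' : List (List X)} {i j y i' j' x} →
                     CellUpdate Q Q' i j y → cell Q' i' j' ≡ just x →
                     ((i' , j') ≡ (i , j) × x ≡ y) ⊎ ((i' , j') ≢ (i , j) × cell Q i' j' ≡ just x)
  cellUpdate-cases {i = i} {j} {i' = i'} {j'} upd cx with ≡-dec _≟_ _≟_ (i' , j') (i , j)
  ... | yes refl = inj₁ (refl , just-injective (trans (sym cx) (updated upd)))
  ... | no ne    = inj₂ (ne , trans (sym (unchanged upd ne)) cx)

module Steps {k m n : ℕ} (A : Shuffle k m) where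

  E : Set
  E = Entry k m n

  T : Set
  T = Tableau k m n

  rk : E → ℕ
  rk e = rank A (proj₁ e)

  Passed≤ : (ℕ → Maybe E) → ℕ → E → Set
  Passed≤ line j y = ∀ j' → j' < j → ∃[ x ] (line j' ≡ just x × rk x ≤ rk y)

  Passed< : (ℕ → Maybe E) → ℕ → E → Set
  Passed< line i y = ∀ i' → i' < i → ∃[ x ] (line i' ≡ just x × rk x < rk y)

  data BumpRowView (y : E) (rw : List E) (j₀ : ℕ) : List E × Maybe (E × ℕ) → Set where
    appends : Passed≤ (at rw) (length rw) y → BumpRowView y rw j₀ (rw ++ [ y ] , nothing)
    bumps   : ∀ j {e} → at rw j ≡ just e → rk y < rk e → Passed≤ (at rw) j y →
              BumpRowView y rw j₀ (setAt rw j y , just (e , j₀ + j))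

  passed≤-∷ : ∀ {y x rw j} → rk x ≤ rk y → Passed≤ (at rw) j y → Passed≤ (at (x ∷ rw)) (suc j) y
  passed≤-∷ x≤y passed zero     _          = _ , refl , x≤y
  passed≤-∷ x≤y passed (suc j') (s≤s j'<j) = passed j' j'<j

  bumpRow-view : ∀ y rw j₀ → BumpRowView y rw j₀ (bumpRow A y rw j₀)
  bumpRow-view y []       j₀ = appends λ _ ()
  bumpRow-view y (e ∷ es) j₀ with rk y <? rk e
  ... | yes y<e = subst (λ j → BumpRowView y (e ∷ es) j₀ (y ∷ es , just (e , j))) (+-identityʳ j₀)
                    (bumps 0 refl y<e λ _ ())
  ... | no y≮e with bumpRow A y es (suc j₀) | bumpRow-view y es (suc j₀)
  ...   | ._ | appends passed = appends (passed≤-∷ {y} {e} {es} (≮⇒≥ y≮e) passed)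
  ...   | ._ | bumps j {e'} ce' y<e' passed =
          subst (λ i → BumpRowView y (e ∷ es) j₀ (e ∷ setAt es j y , just (e' , i))) (+-suc j₀ j)
            (bumps (suc j) ce' y<e' (passed≤-∷ {y} {e} {es} (≮⇒≥ y≮e) passed))

  data RowStepView (r : ℕ) (y : E) (Q : T) : T × Maybe (E × ℕ) → Set where
    appends : ∀ {j Q'} → cell Q r j ≡ nothing → Passed≤ (cell Q r) j y → CellUpdate Q Q' r j y →
              RowStepView r y Q (Q' , nothing)
    bumps   : ∀ {j e Q'} → cell Q r j ≡ just e → rk y < rk e → Passed≤ (cell Q r) j y →
              CellUpdate Q Q' r j y → RowStepView r y Q (Q' , just (e , j))

  rowStep-view : ∀ r y Q → r ≤ length Q → RowStepView r y Q (rowStep A r y Q)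
  rowStep-view zero    y []       _ = appends refl (λ _ ()) cellUpdate-newRow
  rowStep-view zero    y (rw ∷ Q) _ with bumpRow A y rw 0 | bumpRow-view y rw 0
  ... | ._ | appends passed        = appends (length≤⇒at≡nothing rw ≤-refl) passed (cellUpdate-append rw Q)
  ... | ._ | bumps _ ce y<e passed = bumps ce y<e passed (cellUpdate-setAt rw Q ce)
  rowStep-view (suc r) y (rw ∷ Q) (s≤s r≤n) with rowStep A r y Q | rowStep-view r y Q r≤n
  ... | ._ | appends empty passed upd = appends empty passed (cellUpdate-∷ rw upd)
  ... | ._ | bumps ce y<e passed upd  = bumps ce y<e passed (cellUpdate-∷ rw upd)

  data ColStepView (c : ℕ) (y : E) (Q : T) (i₀ : ℕ) : T × Maybe (E × ℕ) → Set where
    appends : ∀ {i j Q'} → cell Q i j ≡ nothing → j ≤ c → Passed< (λ i' → cell Q i' c) i y →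
              CellUpdate Q Q' i j y → ColStepView c y Q i₀ (Q' , nothing)
    bumps   : ∀ i {e Q'} → cell Q i c ≡ just e → rk y ≤ rk e → Passed< (λ i' → cell Q i' c) i y →
              CellUpdate Q Q' i c y → ColStepView c y Q i₀ (Q' , just (e , i₀ + i))

  passed<-∷ : ∀ {y rw Q c i x} → at rw c ≡ just x → rk x < rk y → Passed< (λ i' → cell Q i' c) i y →
              Passed< (λ i' → cell (rw ∷ Q) i' c) (suc i) y
  passed<-∷ cx x<y passed zero     _          = _ , cx , x<y
  passed<-∷ cx x<y passed (suc i') (s≤s i'<i) = passed i' i'<i

  colStep-view : ∀ c y Q i₀ → ColStepView c y Q i₀ (colStep A c y Q i₀)
  colStep-view c y []       i₀ = appends refl z≤n (λ _ ()) cellUpdate-newRow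
  colStep-view c y (rw ∷ Q) i₀ with at rw c in ce
  ... | nothing = appends (length≤⇒at≡nothing rw ≤-refl) (at≡nothing⇒length≤ rw ce) (λ _ ())
                          (cellUpdate-append rw Q)
  ... | just e with rk y ≤? rk e
  ...   | yes y≤e =
          subst (λ i → ColStepView c y (rw ∷ Q) i₀ (setAt rw c y ∷ Q , just (e , i))) (+-identityʳ i₀)
            (bumps 0 ce y≤e (λ _ ()) (cellUpdate-setAt rw Q ce))
  ...   | no y≰e with colStep A c y Q (suc i₀) | colStep-view c y Q (suc i₀)
  ...     | ._ | appends empty j≤c passed upd =
            appends empty j≤c (passed<-∷ {y} {rw} {Q} ce (≰⇒> y≰e) passed) (cellUpdate-∷ rw upd)
  ...     | ._ | bumps i {e'} {Q'} ce' y≤e' passed upd =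
            subst (λ i' → ColStepView c y (rw ∷ Q) i₀ (rw ∷ Q' , just (e' , i'))) (+-suc i₀ i)
              (bumps (suc i) ce' y≤e' (passed<-∷ {y} {rw} {Q} ce (≰⇒> y≰e) passed) (cellUpdate-∷ rw upd))

module Relabel {k m m' n : ℕ} (A : Shuffle k m) (A' : Shuffle k m') (φ : Entry k m n → Entry k m' n) where

  open Steps {n = n} A using (E; T; rk)
  open Equivalence

  rk' : E → ℕ
  rk' e = rank A' (proj₁ (φ e))

  relabelTableau : T → Tableau k m' n
  relabelTableau = map (map φ)

  relabelResult : ∀ {R R' : Set} → (R → R') → R × Maybe (E × ℕ) → R' × Maybe (Entry k m' n × ℕ)
  relabelResult f o = f (proj₁ o) , Maybe.map (map₁ φ) (proj₂ o)

  Agree< Agree≤ : E → E → Set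
  Agree< y x = rk y < rk x ⇔ rk' y < rk' x
  Agree≤ y x = rk y ≤ rk x ⇔ rk' y ≤ rk' x

  at-map : ∀ (rw : List E) c → at (map φ rw) c ≡ Maybe.map φ (at rw c)
  at-map []       c       = refl
  at-map (x ∷ rw) zero    = refl
  at-map (x ∷ rw) (suc c) = at-map rw c

  setAt-map : ∀ (rw : List E) c y → setAt (map φ rw) c (φ y) ≡ map φ (setAt rw c y)
  setAt-map []       c       y = refl
  setAt-map (x ∷ rw) zero    y = refl
  setAt-map (x ∷ rw) (suc c) y = cong (φ x ∷_) (setAt-map rw c y)

  bumpRow-relabel : ∀ y rw j₀ → (∀ {j x} → at rw j ≡ just x → Agree< y x) →
                    bumpRow A' (φ y) (map φ rw) j₀ ≡ relabelResult (map φ) (bumpRow A y rw j₀)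
  bumpRow-relabel y []       j₀ _     = refl
  bumpRow-relabel y (e ∷ es) j₀ agree with rk y <? rk e | rk' y <? rk' e
  ... | yes _   | yes _    = refl
  ... | yes y<e | no y≮'e  = contradiction (to (agree {0} refl) y<e) y≮'e
  ... | no y≮e  | yes y<'e = contradiction (from (agree {0} refl) y<'e) y≮e
  ... | no _    | no _     rewrite bumpRow-relabel y es (suc j₀) (λ {j} → agree {suc j}) = refl

  rowStep-relabel : ∀ r y Q → (∀ {j x} → cell Q r j ≡ just x → Agree< y x) →
                    rowStep A' r (φ y) (relabelTableau Q) ≡ relabelResult relabelTableau (rowStep A r y Q)
  rowStep-relabel r       y []       _     = refl
  rowStep-relabel zero    y (rw ∷ Q) agree rewrite bumpRow-relabel y rw 0 agree = refl
  rowStep-relabel (suc r) y (rw ∷ Q) agree rewrite rowStep-relabel r y Q agree = refl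

  colStep-relabel : ∀ c y Q i₀ → (∀ {i x} → cell Q i c ≡ just x → Agree≤ y x) →
                    colStep A' c (φ y) (relabelTableau Q) i₀ ≡ relabelResult relabelTableau (colStep A c y Q i₀)
  colStep-relabel c y []       i₀ _ = refl
  colStep-relabel c y (rw ∷ Q) i₀ agree with at (map φ rw) c | at rw c in ce | at-map rw c
  ... | ._ | nothing | refl = cong (λ rw' → rw' ∷ relabelTableau Q , nothing) (sym (map-++ φ rw [ y ]))
  ... | ._ | just e  | refl with rk y ≤? rk e | rk' y ≤? rk' e
  ...   | yes _   | yes _    = cong (λ rw' → rw' ∷ relabelTableau Q , just (φ e , i₀)) (setAt-map rw c y)
  ...   | yes y≤e | no y≰'e  = contradiction (to (agree {0} ce) y≤e) y≰'e
  ...   | no y≰e  | yes y≤'e = contradiction (from (agree {0} ce) y≤'e) y≰e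
  ...   | no _    | no _     rewrite colStep-relabel c y Q (suc i₀) (λ {i} → agree {suc i}) = refl

module _ {k m n : ℕ} (A : Shuffle k m) where

  insertAt-deterministic : ∀ {τ y Q P₁ P₂} → InsertAt {n = n} A τ y Q P₁ → InsertAt A τ y Q P₂ →
                           P₁ ≡ P₂
  insertAt-deterministic (row-end e₁)     (row-end e₂)     = cong proj₁ (trans (sym e₁) e₂)
  insertAt-deterministic (row-end e₁)     (row-bump e₂ _)  with () ← trans (sym e₁) e₂
  insertAt-deterministic (row-bump e₁ _)  (row-end e₂)     with () ← trans (sym e₁) e₂
  insertAt-deterministic (row-bump e₁ d₁) (row-bump e₂ d₂) with refl ← trans (sym e₁) e₂ =
    insertAt-deterministic d₁ d₂
  insertAt-deterministic (col-end e₁)     (col-end e₂)     = cong proj₁ (trans (sym e₁) e₂)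
  insertAt-deterministic (col-end e₁)     (col-bump e₂ _)  with () ← trans (sym e₁) e₂
  insertAt-deterministic (col-bump e₁ _)  (col-end e₂)     with () ← trans (sym e₁) e₂
  insertAt-deterministic (col-bump e₁ d₁) (col-bump e₂ d₂) with refl ← trans (sym e₁) e₂ =
    insertAt-deterministic d₁ d₂

  run-deterministic : ∀ {Q es P₁ P₂} → Run {n = n} A Q es P₁ → Run A Q es P₂ → P₁ ≡ P₂
  run-deterministic done          done          = refl
  run-deterministic (step d₁ r₁) (step d₂ r₂) with refl ← insertAt-deterministic d₁ d₂ =
    run-deterministic r₁ r₂

Fin-bounded : ∀ {N} (f : Fin N → ℕ) → ∃[ R ] (∀ i → f i ≤ R)
Fin-bounded {zero}  f = 0 , λ ()
Fin-bounded {suc N} f with Fin-bounded (f ∘ Fin.suc)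
... | R , bound = f zero ⊔ R , λ { zero → m≤m⊔n _ R ; (suc i) → ≤-trans (bound i) (m≤n⊔m (f zero) R) }

rank-bounded : ∀ {k m} (A : Shuffle k m) → ∃[ R ] (∀ x → rank A x ≤ R)
rank-bounded A with Fin-bounded (rank A ∘ t) | Fin-bounded (rank A ∘ u)
... | Rt , bt | Ru , bu =
  Rt ⊔ Ru , λ { (t a) → ≤-trans (bt a) (m≤m⊔n Rt Ru) ; (u a) → ≤-trans (bu a) (m≤n⊔m Rt Ru) }

lookup-zip-allFin : ∀ {X : Set} {n} (xs : Vec X n) p → lookup (zip xs (allFin n)) p ≡ (lookup xs p , p)
lookup-zip-allFin {n = n} xs p = trans (lookup-zip p xs (allFin n)) (cong (lookup xs p ,_) (lookup-allFin p))

module Invariants {k m n : ℕ} (A : Shuffle k m) (v : Word k m n) where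

  open Steps {n = n} A public

  pos : E → ℕ
  pos e = toℕ (proj₂ e)

  Occurs : E → Set
  Occurs (x , p) = x ≡ lookup v p

  OccursBefore : ℕ → E → Set
  OccursBefore B e = Occurs e × pos e < B

  ColumnStrict RowWeak StripOrder : T → Set
  ColumnStrict Q = ∀ {i j x} → cell Q (suc i) j ≡ just x → ∃[ z ] (cell Q i j ≡ just z × rk z < rk x)
  RowWeak      Q = ∀ {i j x} → cell Q i (suc j) ≡ just x → ∃[ z ] (cell Q i j ≡ just z × rk z ≤ rk x)
  StripOrder   Q = ∀ {a p p' i j i' j'} → cell Q i j ≡ just (u a , p) → cell Q i' j' ≡ just (u a , p') →
                   j < j' → toℕ p' < toℕ p

  record Invariant (B : ℕ) (Q : T) : Set where
    field
      columnStrict : ColumnStrict Q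
      rowWeak      : RowWeak Q
      stripOrder   : StripOrder Q
      occursBefore : AllCells (OccursBefore B) Q

  open Invariant public

  module _ {B Q} (inv : Invariant B Q) where

    above< : ∀ {i i₀ j x} → i < i₀ → cell Q i₀ j ≡ just x →
             ∃[ z ] (cell Q i j ≡ just z × rk z < rk x)
    above< {i₀ = suc i₀} (s≤s i≤i₀) cx with columnStrict inv cx
    ... | z , cz , z<x with m≤n⇒m<n∨m≡n i≤i₀
    ...   | inj₂ refl = z , cz , z<x
    ...   | inj₁ i<i₀ with above< i<i₀ cz
    ...     | z' , cz' , z'<z = z' , cz' , <-trans z'<z z<x

    above≤ : ∀ {i i₀ j x} → i ≤ i₀ → cell Q i₀ j ≡ just x →
             ∃[ z ] (cell Q i j ≡ just z × rk z ≤ rk x)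
    above≤ i≤i₀ cx with m≤n⇒m<n∨m≡n i≤i₀
    ... | inj₂ refl = _ , cx , ≤-refl
    ... | inj₁ i<i₀ with above< i<i₀ cx
    ...   | z , cz , z<x = z , cz , <⇒≤ z<x

    left≤ : ∀ {i j j₀ x} → j ≤ j₀ → cell Q i j₀ ≡ just x →
            ∃[ z ] (cell Q i j ≡ just z × rk z ≤ rk x)
    left≤ {j₀ = zero}   z≤n cx = _ , cx , ≤-refl
    left≤ {j₀ = suc j₀} j≤j₀ cx with m≤n⇒m<n∨m≡n j≤j₀
    ... | inj₂ refl = _ , cx , ≤-refl
    ... | inj₁ (s≤s j≤j₀') with rowWeak inv cx
    ...   | z , cz , z≤x with left≤ j≤j₀' cz
    ...     | z' , cz' , z'≤z = z' , cz' , ≤-trans z'≤z z≤x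

    below> : ∀ {i j e x} → cell Q i j ≡ just e → cell Q (suc i) j ≡ just x → rk e < rk x
    below> ce cx with columnStrict inv cx
    ... | _ , cz , z<x with refl ← trans (sym ce) cz = z<x

    right≥ : ∀ {i j e x} → cell Q i j ≡ just e → cell Q i (suc j) ≡ just x → rk e ≤ rk x
    right≥ ce cx with rowWeak inv cx
    ... | _ , cz , z≤x with refl ← trans (sym ce) cz = z≤x

    nothing-below : ∀ {i j x} → cell Q i j ≡ nothing → cell Q (suc i) j ≡ just x → ⊥
    nothing-below empty cx with columnStrict inv cx
    ... | _ , cz , _ with () ← trans (sym empty) cz

    nothing-right : ∀ {i j x} → cell Q i j ≡ nothing → cell Q i (suc j) ≡ just x → ⊥
    nothing-right empty cx with rowWeak inv cx
    ... | _ , cz , _ with () ← trans (sym empty) cz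

    sameLetter-sameRow : ∀ {i i' j x x'} → cell Q i j ≡ just x → cell Q i' j ≡ just x' →
                         proj₁ x ≡ proj₁ x' → i ≡ i'
    sameLetter-sameRow {i} {i'} cx cx' same with <-cmp i i'
    ... | tri≈ _ i≡i' _ = i≡i'
    ... | tri< i<i' _ _ with above< i<i' cx'
    ...   | _ , cz , z<x' with refl ← trans (sym cx) cz = contradiction (cong (rank A) same) (<⇒≢ z<x')
    sameLetter-sameRow {i} {i'} cx cx' same | tri> _ _ i'<i with above< i'<i cx
    ...   | _ , cz , z<x with refl ← trans (sym cx') cz = contradiction (cong (rank A) (sym same)) (<⇒≢ z<x)

  Above : T → ℕ → ℕ → E → Set
  Above Q zero    j y = ⊤
  Above Q (suc i) j y = ∃[ z ] (cell Q i j ≡ just z × rk z < rk y)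

  LeftOf : T → ℕ → ℕ → E → Set
  LeftOf Q i zero    y = ⊤
  LeftOf Q i (suc j) y = ∃[ z ] (cell Q i j ≡ just z × rk z ≤ rk y)

  FitsStripAt : ℕ → Fin m → Fin n → T → Set
  FitsStripAt c a p Q = ∀ {i j p'} → cell Q i j ≡ just (u a , p') →
                        (c ≤ j → toℕ p' < toℕ p) × (j < c → toℕ p < toℕ p')

  StripSafe : ℕ → E → T → Set
  StripSafe c (t _ , _) Q = ⊤
  StripSafe c (u a , p) Q = FitsStripAt c a p Q

  record Placement (B : ℕ) (Q : T) (i j : ℕ) (y : E) : Set where
    field
      above : Above Q i j y
      left  : LeftOf Q i j y
      below : ∀ {x} → cell Q (suc i) j ≡ just x → rk y < rk x
      right : ∀ {x} → cell Q i (suc j) ≡ just x → rk y ≤ rk x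
      strip : StripSafe j y Q
      fresh : OccursBefore B y

  module _ {B Q Q' i j y} (inv : Invariant B Q) (upd : CellUpdate Q Q' i j y) (pl : Placement B Q i j y) where

    open Placement pl

    place-columnStrict : ColumnStrict Q'
    place-columnStrict {i₁} {j₁} cx with cellUpdate-cases upd cx
    ... | inj₁ (refl , refl) with z , cz , z<y ← above = z , trans (unchanged upd (below≢ ∘ sym)) cz , z<y
    ... | inj₂ (_ , cx) with columnStrict inv cx | ≡-dec _≟_ _≟_ (i₁ , j₁) (i , j)
    ...   | _ , _ , _    | yes refl = y , updated upd , below cx
    ...   | z , cz , z<x | no ne    = z , trans (unchanged upd ne) cz , z<x

    place-rowWeak : RowWeak Q'
    place-rowWeak {i₁} {j₁} cx with cellUpdate-cases upd cx
    ... | inj₁ (refl , refl) with z , cz , z≤y ← left = z , trans (unchanged upd (right≢ ∘ sym)) cz , z≤y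
    ... | inj₂ (_ , cx) with rowWeak inv cx | ≡-dec _≟_ _≟_ (i₁ , j₁) (i , j)
    ...   | _ , _ , _    | yes refl = y , updated upd , right cx
    ...   | z , cz , z≤x | no ne    = z , trans (unchanged upd ne) cz , z≤x

    place-stripOrder : StripOrder Q'
    place-stripOrder cx cx' j<j' with cellUpdate-cases upd cx | cellUpdate-cases upd cx'
    ... | inj₁ (refl , refl) | inj₁ (refl , _)    = contradiction j<j' (<-irrefl refl)
    ... | inj₁ (refl , refl) | inj₂ (_ , cx')     = proj₁ (strip cx') (<⇒≤ j<j')
    ... | inj₂ (_ , cx)      | inj₁ (refl , refl) = proj₂ (strip cx) j<j'
    ... | inj₂ (_ , cx)      | inj₂ (_ , cx')     = stripOrder inv cx cx' j<j'

    place-occursBefore : AllCells (OccursBefore B) Q'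
    place-occursBefore cx with cellUpdate-cases upd cx
    ... | inj₁ (_ , refl) = fresh
    ... | inj₂ (_ , cx)   = occursBefore inv cx

    place : Invariant B Q'
    place = record
      { columnStrict = place-columnStrict
      ; rowWeak      = place-rowWeak
      ; stripOrder   = place-stripOrder
      ; occursBefore = place-occursBefore
      }

  -- An entry waiting for row r + 1 (column c + 1) was bumped out of row r (column c), and the
  -- cell it left now holds the entry that bumped it.
  SupportAbove : T → ℕ → Letter k m → Set
  SupportAbove Q zero    x = ⊤
  SupportAbove Q (suc r) x = ∃[ j ] ∃[ z ] (cell Q r j ≡ just z × rk z < rank A x ×
                             (∀ {x'} → cell Q (suc r) j ≡ just x' → rank A x < rk x'))

  SupportLeft : T → ℕ → Letter k m → Set
  SupportLeft Q zero    x = ⊤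
  SupportLeft Q (suc c) x = ∃[ i ] ∃[ z ] (cell Q i c ≡ just z × rk z ≤ rank A x ×
                            (∀ {x'} → cell Q i (suc c) ≡ just x' → rank A x ≤ rk x'))

  data Ready (Q : T) : Target → E → Set where
    rowReady : ∀ {r a p} → SupportAbove Q r (t a) → Ready Q (row r) (t a , p)
    colReady : ∀ {c a p} → FitsStripAt c a p Q → SupportLeft Q c (u a) → Ready Q (col c) (u a , p)

  Pending : ℕ → T → Target → E → Set
  Pending B Q τ y = OccursBefore B y × Ready Q τ y

  _≺_ : E → E → Set
  y ≺ e = rk y < rk e ⊎ (proj₁ e ≡ proj₁ y × pos e < pos y)

  supportAbove-length : ∀ {Q r x} → SupportAbove Q r x → r ≤ length Q
  supportAbove-length {r = zero}  _                = z≤n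
  supportAbove-length {Q} {suc r} (_ , _ , cz , _) = cell≡just⇒<length Q cz

  passed-left : ∀ {Q i j y} → Passed≤ (cell Q i) j y → LeftOf Q i j y
  passed-left {j = zero}  _      = tt
  passed-left {j = suc j} passed = passed j ≤-refl

  passed-above : ∀ {Q i c y} → Passed< (λ i' → cell Q i' c) i y → Above Q i c y
  passed-above {i = zero}  _      = tt
  passed-above {i = suc i} passed = passed i ≤-refl

  row-above : ∀ {B Q r j x p} → Invariant B Q → SupportAbove Q r x → Passed≤ (cell Q r) j (x , p) →
              Above Q r j (x , p)
  row-above {r = zero}        _   _                             _      = tt
  row-above {r = suc r} {j} inv (j₀ , z , cz , z<y , below) passed with j ≤? j₀
  ... | yes j≤j₀ with z' , cz' , z'≤z ← left≤ inv j≤j₀ cz = z' , cz' , ≤-<-trans z'≤z z<y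
  ... | no j≰j₀  with _ , cx , x≤y ← passed j₀ (≰⇒> j≰j₀) = contradiction (below cx) (≤⇒≯ x≤y)

  col-left : ∀ {B Q c i x p} → Invariant B Q → SupportLeft Q c x →
             Passed< (λ i' → cell Q i' c) i (x , p) → LeftOf Q i c (x , p)
  col-left {c = zero}        _   _                             _      = tt
  col-left {c = suc c} {i} inv (i₀ , z , cz , z≤y , right) passed with i ≤? i₀
  ... | yes i≤i₀ with z' , cz' , z'≤z ← above≤ inv i≤i₀ cz = z' , cz' , ≤-trans z'≤z z≤y
  ... | no i≰i₀  with _ , cx , x<y ← passed i₀ (≰⇒> i≰i₀) = contradiction (right cx) (<⇒≱ x<y)

  -- colStep appends to the end of the first row without a cell in column c; that end is
  -- column c only because the cell to its left is filled.
  append-column : ∀ {Q i j c y} → LeftOf Q i c y → cell Q i j ≡ nothing → j ≤ c → j ≡ c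
  append-column {c = zero} _ _ j≤0 = n≤0⇒n≡0 j≤0
  append-column {Q} {j = j} {suc c} (_ , cz , _) empty j≤c with j ≤? c
  ... | yes j≤c' with () ← trans (sym cz) (cell≡nothing-mono Q j≤c' empty)
  ... | no j≰c' = ≤-antisym j≤c (≰⇒> j≰c')

  fits-right-of : ∀ {B Q Q' i j y b q} → Invariant B Q → CellUpdate Q Q' i j y →
                  cell Q i j ≡ just (u b , q) →
                  (∀ {p'} → y ≡ (u b , p') → toℕ q < toℕ p') → FitsStripAt (suc j) b q Q'
  fits-right-of {j = j} {q = q} inv upd ce later {_} {j₁} {p'} cx with cellUpdate-cases upd cx
  ... | inj₁ (refl , refl) = (λ j<j → contradiction j<j (<-irrefl refl)) , (λ _ → later refl)
  ... | inj₂ (ne , cx)     = (λ j<j₁ → stripOrder inv ce cx j<j₁) , leftOf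
    where
      leftOf : j₁ < suc j → toℕ q < toℕ p'
      leftOf (s≤s j₁≤j) with m≤n⇒m<n∨m≡n j₁≤j
      ... | inj₁ j₁<j = stripOrder inv cx ce j₁<j
      ... | inj₂ refl = contradiction (cong (_, j) (sameLetter-sameRow inv cx ce refl)) ne

  row-placement : ∀ {B Q r j a p} → Invariant B Q → OccursBefore B (t a , p) → SupportAbove Q r (t a) →
                  Passed≤ (cell Q r) j (t a , p) →
                  (∀ {x} → cell Q (suc r) j ≡ just x → rank A (t a) < rk x) →
                  (∀ {x} → cell Q r (suc j) ≡ just x → rank A (t a) ≤ rk x) → Placement B Q r j (t a , p)
  row-placement inv fresh sup passed below right = record
    { above = row-above inv sup passed ; left = passed-left passed ; below = below ; right = right
    ; strip = tt ; fresh = fresh }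

  col-placement : ∀ {B Q c i a p} → Invariant B Q → OccursBefore B (u a , p) → FitsStripAt c a p Q →
                  SupportLeft Q c (u a) → Passed< (λ i' → cell Q i' c) i (u a , p) →
                  (∀ {x} → cell Q (suc i) c ≡ just x → rank A (u a) < rk x) →
                  (∀ {x} → cell Q i (suc c) ≡ just x → rank A (u a) ≤ rk x) → Placement B Q i c (u a , p)
  col-placement inv fresh fits sup passed below right = record
    { above = passed-above passed ; left = col-left inv sup passed ; below = below ; right = right
    ; strip = fits ; fresh = fresh }

  rowStep-end : ∀ {B Q Q' r y} → Invariant B Q → Pending B Q (row r) y → rowStep A r y Q ≡ (Q' , nothing) →
                Invariant B Q'
  rowStep-end {Q = Q} {r = r} inv (fresh , rowReady sup) eq
    with subst (RowStepView r _ Q) eq (rowStep-view r _ Q (supportAbove-length sup))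
  ... | appends empty passed upd =
        place inv upd (row-placement inv fresh sup passed (⊥-elim ∘ nothing-below inv empty)
                                                          (⊥-elim ∘ nothing-right inv empty))

  rowBumped : ∀ {B Q Q' r j a p e} → Invariant B Q → CellUpdate Q Q' r j (t a , p) → cell Q r j ≡ just e →
              rank A (t a) < rk e → Pending B Q' (next e r j) e
  rowBumped {j = j} {e = t _ , _} inv upd ce y<e =
    occursBefore inv ce , rowReady (j , _ , updated upd , y<e , below> inv ce ∘ trans (sym (unchanged upd below≢)))
  rowBumped {r = r} {e = u _ , _} inv upd ce y<e =
    occursBefore inv ce , colReady (fits-right-of inv upd ce λ ())
      (r , _ , updated upd , <⇒≤ y<e , right≥ inv ce ∘ trans (sym (unchanged upd right≢)))

  rowStep-bump : ∀ {B Q Q' r y e j} → Invariant B Q → Pending B Q (row r) y →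
                 rowStep A r y Q ≡ (Q' , just (e , j)) →
                 Invariant B Q' × Pending B Q' (next e r j) e × y ≺ e
  rowStep-bump {Q = Q} {r = r} inv (fresh , rowReady sup) eq
    with subst (RowStepView r _ Q) eq (rowStep-view r _ Q (supportAbove-length sup))
  ... | bumps ce y<e passed upd =
        place inv upd (row-placement inv fresh sup passed (<-trans y<e ∘ below> inv ce)
                                                          (≤-trans (<⇒≤ y<e) ∘ right≥ inv ce))
      , rowBumped inv upd ce y<e
      , inj₁ y<e

  colStep-end : ∀ {B Q Q' c y} → Invariant B Q → Pending B Q (col c) y →
                colStep A c y Q 0 ≡ (Q' , nothing) →
                Invariant B Q'
  colStep-end {Q = Q} {c = c} inv (fresh , colReady {a = a} {p} fits sup) eq
    with subst (ColStepView c _ Q 0) eq (colStep-view c _ Q 0)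
  ... | appends {i} empty j≤c passed upd
    with refl ← append-column {Q} (col-left {c = c} {i} {u a} {p} inv sup passed) empty j≤c =
        place inv upd (col-placement inv fresh fits sup passed (⊥-elim ∘ nothing-below inv empty)
                                                               (⊥-elim ∘ nothing-right inv empty))

  colBumped : ∀ {B Q Q' i c a p e} → Invariant B Q → CellUpdate Q Q' i c (u a , p) → FitsStripAt c a p Q →
              cell Q i c ≡ just e → rank A (u a) ≤ rk e → Pending B Q' (next e i c) e
  colBumped {c = c} {a} {e = t b , _} inv upd _ ce y≤e =
    occursBefore inv ce , rowReady (c , _ , updated upd , y<e , below> inv ce ∘ trans (sym (unchanged upd below≢)))
    where
      y<e : rank A (u a) < rank A (t b)
      y<e = ≤∧≢⇒< y≤e λ same → case rank-injective A (u a) (t b) same of λ ()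
  colBumped {i = i} {e = u _ , _} inv upd fits ce y≤e =
    occursBefore inv ce , colReady (fits-right-of inv upd ce λ { refl → proj₁ (fits ce) ≤-refl })
      (i , _ , updated upd , y≤e , right≥ inv ce ∘ trans (sym (unchanged upd right≢)))

  colBump-progress : ∀ {Q i c a p e} → FitsStripAt c a p Q → cell Q i c ≡ just e → rank A (u a) ≤ rk e →
                     (u a , p) ≺ e
  colBump-progress {e = _ , _} fits ce y≤e with m≤n⇒m<n∨m≡n y≤e
  ... | inj₁ y<e  = inj₁ y<e
  ... | inj₂ same with refl ← rank-injective A _ _ same = inj₂ (refl , proj₁ (fits ce) ≤-refl)

  colStep-bump : ∀ {B Q Q' c y e i} → Invariant B Q → Pending B Q (col c) y →
                 colStep A c y Q 0 ≡ (Q' , just (e , i)) →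
                 Invariant B Q' × Pending B Q' (next e i c) e × y ≺ e
  colStep-bump {Q = Q} {c = c} inv (fresh , colReady fits sup) eq
    with subst (ColStepView c _ Q 0) eq (colStep-view c _ Q 0)
  ... | bumps _ ce y≤e passed upd =
        place inv upd (col-placement inv fresh fits sup passed (≤-<-trans y≤e ∘ below> inv ce)
                                                               (≤-trans y≤e ∘ right≥ inv ce))
      , colBumped inv upd fits ce y≤e
      , colBump-progress {Q} fits ce y≤e

  Rmax : ℕ
  Rmax = proj₁ (rank-bounded A)

  weight : E → ℕ × ℕ
  weight y = Rmax ∸ rk y , pos y

  _⊏_ : ℕ × ℕ → ℕ × ℕ → Set
  _⊏_ = ×-Lex _≡_ _<_ _<_

  ⊏-wellFounded : WellFounded _⊏_
  ⊏-wellFounded = ×-wellFounded <-wellFounded <-wellFounded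

  ≺⇒⊏ : ∀ {y e} → y ≺ e → weight e ⊏ weight y
  ≺⇒⊏ {e = e} (inj₁ y<e)  = inj₁ (∸-monoʳ-< y<e (proj₂ (rank-bounded A) (proj₁ e)))
  ≺⇒⊏ (inj₂ (same , e<y)) = inj₂ (cong (λ x → Rmax ∸ rank A x) same , e<y)

  insertAt-exists : ∀ {B τ y Q} → Invariant B Q → Pending B Q τ y → Acc _⊏_ (weight y) →
                    ∃[ Q'' ] InsertAt A τ y Q Q''
  insertAt-exists {τ = row r} {y} {Q} inv pd (acc rs) with rowStep A r y Q in eq
  ... | Q' , nothing = Q' , row-end eq
  ... | _ , just _ with inv' , pd' , y≺e ← rowStep-bump inv pd eq =
        map₂ (row-bump eq) (insertAt-exists inv' pd' (rs (≺⇒⊏ y≺e)))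
  insertAt-exists {τ = col c} {y} {Q} inv pd (acc rs) with colStep A c y Q 0 in eq
  ... | Q' , nothing = Q' , col-end eq
  ... | _ , just _ with inv' , pd' , y≺e ← colStep-bump inv pd eq =
        map₂ (col-bump eq) (insertAt-exists inv' pd' (rs (≺⇒⊏ y≺e)))

  insertAt-invariant : ∀ {B τ y Q Q''} → Invariant B Q → Pending B Q τ y → InsertAt A τ y Q Q'' →
                       Invariant B Q''
  insertAt-invariant inv pd (row-end eq)    = rowStep-end inv pd eq
  insertAt-invariant inv pd (row-bump eq d) with inv' , pd' , _ ← rowStep-bump inv pd eq =
    insertAt-invariant inv' pd' d
  insertAt-invariant inv pd (col-end eq)    = colStep-end inv pd eq
  insertAt-invariant inv pd (col-bump eq d) with inv' , pd' , _ ← colStep-bump inv pd eq =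
    insertAt-invariant inv' pd' d

  IncreasingFrom : ℕ → List E → Set
  IncreasingFrom B []       = ⊤
  IncreasingFrom B (e ∷ es) = B ≤ pos e × IncreasingFrom (suc (pos e)) es

  invariant-[] : ∀ {B} → Invariant B []
  invariant-[] = record { columnStrict = λ () ; rowWeak = λ () ; stripOrder = λ () ; occursBefore = λ () }

  nextEntry : ∀ {B Q e} → Invariant B Q → B ≤ pos e → Occurs e →
              Invariant (suc (pos e)) Q × Pending (suc (pos e)) Q (start e) e
  nextEntry {e = x , p} inv B≤p occ = inv' , pending x occ
    where
      earlier : ∀ {y} → OccursBefore _ y → pos y < toℕ p
      earlier (_ , y<B) = <-≤-trans y<B B≤p

      inv' : Invariant (suc (toℕ p)) _
      inv' = record
        { columnStrict = columnStrict inv ; rowWeak = rowWeak inv ; stripOrder = stripOrder inv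
        ; occursBefore = λ cx → proj₁ (occursBefore inv cx) , <-trans (earlier (occursBefore inv cx)) (n<1+n _) }

      pending : ∀ x → x ≡ lookup v p → Pending (suc (toℕ p)) _ (start (x , p)) (x , p)
      pending (t a) occ = (occ , ≤-refl) , rowReady tt
      pending (u a) occ = (occ , ≤-refl) , colReady (λ cx → (λ _ → earlier (occursBefore inv cx)) , λ ()) tt

  run-exists : ∀ {B Q es} → Invariant B Q → IncreasingFrom B es → All Occurs es → ∃[ P ] Run A Q es P
  run-exists inv _ [] = _ , done
  run-exists inv (B≤e , inc) (occ ∷ occs) with inv₁ , pd ← nextEntry inv B≤e occ
    with _ , d ← insertAt-exists inv₁ pd (⊏-wellFounded _) =
    map₂ (step d) (run-exists (insertAt-invariant inv₁ pd d) inc occs)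

  toList-increasing : ∀ {N} B (xs : Vec E N) → (∀ i → pos (lookup xs i) ≡ B + toℕ i) →
                      IncreasingFrom B (toList xs)
  toList-increasing B Vec.[]       _ = tt
  toList-increasing B (x Vec.∷ xs) h rewrite trans (h zero) (+-identityʳ B) =
    ≤-refl , toList-increasing (suc B) xs (λ i → trans (h (suc i)) (+-suc B (toℕ i)))

  occurrences-increasing : IncreasingFrom 0 (occurrences v)
  occurrences-increasing = toList-increasing 0 _ (cong pos ∘ lookup-zip-allFin v)

  occurrences-occur : All Occurs (occurrences v)
  occurrences-occur = toList⁺ (lookup⁻ λ p → subst Occurs (sym (lookup-zip-allFin v p)) refl)

  insTab-exists : ∃[ P ] InsTab A v P
  insTab-exists = run-exists invariant-[] occurrences-increasing occurrences-occur

data SameKind {k m m'} : Letter k m → Letter k m' → Set where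
  t~t : ∀ {a b} → SameKind (t a) (t b)
  u~u : ∀ {a b} → SameKind (u a) (u b)

next-sameKind : ∀ {k m m' n} {x : Letter k m} {x' : Letter k m'} {p : Fin n} →
                SameKind x x' → ∀ i j → next (x' , p) i j ≡ next (x , p) i j
next-sameKind t~t i j = refl
next-sameKind u~u i j = refl

start-sameKind : ∀ {k m m' n} {x : Letter k m} {x' : Letter k m'} {p : Fin n} →
                 SameKind x x' → start (x' , p) ≡ start (x , p)
start-sameKind t~t = refl
start-sameKind u~u = refl

-- Every comparison that inserting v under A can make has the same outcome for w under A'.
record Compatible {k m m' n} (v : Word k m n) (A : Shuffle k m) (w : Word k m' n) (A' : Shuffle k m') : Set where
  field
    sameKind : ∀ p → SameKind (lookup v p) (lookup w p)
    rowAgree : ∀ {a p} q → t a ≡ lookup v p →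
               rank A (t a) < rank A (lookup v q) ⇔ rank A' (lookup w p) < rank A' (lookup w q)
    colAgree : ∀ {a p} q → u a ≡ lookup v p → (lookup v q ≡ u a → q <ᶠ p) →
               rank A (u a) ≤ rank A (lookup v q) ⇔ rank A' (lookup w p) ≤ rank A' (lookup w q)

occurrences-relabel : ∀ {k m m' n} (v : Word k m n) (w : Word k m' n) →
                      occurrences w ≡ map (λ e → lookup w (proj₂ e) , proj₂ e) (occurrences v)
occurrences-relabel {n = n} v w = begin
  toList (zip w (allFin n))                          ≡⟨ cong toList (zip-allFin w) ⟩
  toList (tabulate λ p → lookup w p , p)             ≡⟨ cong toList (tabulate-∘ φ _) ⟩
  toList (Vec.map φ (tabulate λ p → lookup v p , p)) ≡⟨ toList-map φ _ ⟩
  map φ (toList (tabulate λ p → lookup v p , p))     ≡⟨ cong (map φ ∘ toList) (zip-allFin v) ⟨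
  map φ (toList (zip v (allFin n)))                  ∎
  where
    open ≡-Reasoning
    φ = λ (e : Entry _ _ n) → lookup w (proj₂ e) , proj₂ e
    zip-allFin : ∀ {X : Set} (xs : Vec X n) → zip xs (allFin n) ≡ tabulate λ p → lookup xs p , p
    zip-allFin xs = trans (sym (tabulate∘lookup _)) (tabulate-cong (lookup-zip-allFin xs))

module Lockstep {k m m' n} {v : Word k m n} {A : Shuffle k m} {w : Word k m' n} {A' : Shuffle k m'}
                (compatible : Compatible v A w A') where

  open Invariants A v
  open Compatible compatible

  φ : E → Entry k m' n
  φ e = lookup w (proj₂ e) , proj₂ e

  open Relabel A A' φ

  next-relabel : ∀ {e} → Occurs e → ∀ i j → next (φ e) i j ≡ next e i j
  next-relabel {_ , p} refl = next-sameKind (sameKind p)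

  start-relabel : ∀ {e} → Occurs e → start (φ e) ≡ start e
  start-relabel {_ , p} refl = start-sameKind (sameKind p)

  agree< : ∀ {a p x} → t a ≡ lookup v p → Occurs x → Agree< (t a , p) x
  agree< {x = _ , q} vp refl = rowAgree q vp

  agree≤ : ∀ {a p x} → u a ≡ lookup v p → Occurs x → (proj₁ x ≡ u a → proj₂ x <ᶠ p) →
           Agree≤ (u a , p) x
  agree≤ {x = _ , q} vp refl = colAgree q vp

  fits-column : ∀ {Q i c a p x} → FitsStripAt c a p Q → cell Q i c ≡ just x →
                proj₁ x ≡ u a → proj₂ x <ᶠ p
  fits-column {x = _ , q} fits cx refl = proj₁ (fits cx) ≤-refl

  rowStep-agrees : ∀ {B Q r y} → Invariant B Q → Pending B Q (row r) y →
                   rowStep A' r (φ y) (relabelTableau Q) ≡ relabelResult relabelTableau (rowStep A r y Q)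
  rowStep-agrees {Q = Q} {r} {y} inv ((vp , _) , rowReady _) =
    rowStep-relabel r y Q λ cx → agree< vp (proj₁ (occursBefore inv cx))

  colStep-agrees : ∀ {B Q c y} → Invariant B Q → Pending B Q (col c) y →
                   colStep A' c (φ y) (relabelTableau Q) 0 ≡ relabelResult relabelTableau (colStep A c y Q 0)
  colStep-agrees {Q = Q} {c} {y} inv ((vp , _) , colReady {a = a} {p} fits _) =
    colStep-relabel c y Q 0 λ cx →
      agree≤ vp (proj₁ (occursBefore inv cx)) (fits-column {Q} {c = c} {a} {p} fits cx)

  insertAt-relabel : ∀ {B τ y Q Q''} → Invariant B Q → Pending B Q τ y → InsertAt A τ y Q Q'' →
                     InsertAt A' τ (φ y) (relabelTableau Q) (relabelTableau Q'')
  insertAt-relabel inv pd (row-end eq) =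
    row-end (trans (rowStep-agrees inv pd) (cong (relabelResult relabelTableau) eq))
  insertAt-relabel inv pd (row-bump {r = r} {j = j} eq d)
    with inv' , pd'@((occ , _) , _) , _ ← rowStep-bump inv pd eq =
    row-bump (trans (rowStep-agrees inv pd) (cong (relabelResult relabelTableau) eq))
             (subst (λ τ → InsertAt A' τ _ _ _) (sym (next-relabel occ r j)) (insertAt-relabel inv' pd' d))
  insertAt-relabel inv pd (col-end eq) =
    col-end (trans (colStep-agrees inv pd) (cong (relabelResult relabelTableau) eq))
  insertAt-relabel inv pd (col-bump {c = c} {i = i} eq d)
    with inv' , pd'@((occ , _) , _) , _ ← colStep-bump inv pd eq =
    col-bump (trans (colStep-agrees inv pd) (cong (relabelResult relabelTableau) eq))
             (subst (λ τ → InsertAt A' τ _ _ _) (sym (next-relabel occ i c)) (insertAt-relabel inv' pd' d))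

  run-relabel : ∀ {B Q es P} → Invariant B Q → IncreasingFrom B es → All Occurs es → Run A Q es P →
                Run A' (relabelTableau Q) (map φ es) (relabelTableau P)
  run-relabel inv _ [] done = done
  run-relabel inv (B≤e , inc) (occ ∷ occs) (step d r) with inv₁ , pd ← nextEntry inv B≤e occ =
    step (subst (λ τ → InsertAt A' τ _ _ _) (sym (start-relabel occ)) (insertAt-relabel inv₁ pd d))
         (run-relabel (insertAt-invariant inv₁ pd d) inc occs r)

  insTab-relabel : ∀ {P} → InsTab A v P → InsTab A' w (relabel w P)
  insTab-relabel r = subst (λ es → Run A' [] es _) (sym (occurrences-relabel v w))
                       (run-relabel invariant-[] occurrences-increasing occurrences-occur r)

lex-< : ∀ {M X Y s s'} → s < M → X < Y → X * M + s < Y * M + s'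
lex-< {M} {X} {Y} {s} {s'} s<M X<Y = begin-strict
  X * M + s  <⟨ +-monoʳ-< (X * M) s<M ⟩
  X * M + M  ≡⟨ +-comm (X * M) M ⟩
  suc X * M  ≤⟨ *-monoˡ-≤ M X<Y ⟩
  Y * M      ≤⟨ m≤m+n (Y * M) s' ⟩
  Y * M + s' ∎
  where open ≤-Reasoning

lex-<⁻¹ : ∀ {M X Y s s'} → s' < M → X * M + s < Y * M + s' → X < Y ⊎ (X ≡ Y × s < s')
lex-<⁻¹ {M} {X} {Y} s'<M lt with <-cmp X Y
... | tri< X<Y _ _  = inj₁ X<Y
... | tri≈ _ refl _ = inj₂ (refl , +-cancelˡ-< (X * M) _ _ lt)
... | tri> _ _ Y<X  = contradiction (lex-< s'<M Y<X) (<-asym lt)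

lex-injective : ∀ {M X Y s s'} → s < M → s' < M → X * M + s ≡ Y * M + s' → X ≡ Y × s ≡ s'
lex-injective {M} {X} {Y} s<M s'<M eq with <-cmp X Y
... | tri< X<Y _ _  = contradiction eq (<⇒≢ (lex-< s<M X<Y))
... | tri≈ _ refl _ = refl , +-cancelˡ-≡ (X * M) _ _ eq
... | tri> _ _ Y<X  = contradiction (sym eq) (<⇒≢ (lex-< s'<M Y<X))

toℕ-splitAt₁ : ∀ {b n} {c : Fin (b + n)} {x} → splitAt b c ≡ inj₁ x → toℕ c ≡ toℕ x
toℕ-splitAt₁ {n = n} {x = x} eq = trans (cong toℕ (sym (splitAt⁻¹-↑ˡ eq))) (toℕ-↑ˡ x n)

toℕ-splitAt₂ : ∀ {b n} {c : Fin (b + n)} {x} → splitAt b c ≡ inj₂ x → toℕ c ≡ b + toℕ x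
toℕ-splitAt₂ {b} {x = x} eq = trans (cong toℕ (sym (splitAt⁻¹-↑ʳ eq))) (toℕ-↑ʳ b x)

blockElem : ∀ {l} (β : Vec ℕ l) (j : Fin l) → Fin (lookup β j) → Fin (sum β)
blockElem (b Vec.∷ β) zero    o = o ↑ˡ sum β
blockElem (b Vec.∷ β) (suc j) o = b ↑ʳ blockElem β j o

block : ∀ {l} (β : Vec ℕ l) → Fin (sum β) → Fin l
block (b Vec.∷ β) a with splitAt b a
... | inj₁ _  = zero
... | inj₂ a' = suc (block β a')

block-blockElem : ∀ {l} (β : Vec ℕ l) j o → block β (blockElem β j o) ≡ j
block-blockElem (b Vec.∷ β) zero    o rewrite splitAt-↑ˡ b o (sum β) = refl
block-blockElem (b Vec.∷ β) (suc j) o rewrite splitAt-↑ʳ b (sum β) (blockElem β j o) =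
  cong suc (block-blockElem β j o)

blockElem-injectiveˡ : ∀ {l} (β : Vec ℕ l) {j j' o o'} → blockElem β j o ≡ blockElem β j' o' → j ≡ j'
blockElem-injectiveˡ β {j} {j'} eq =
  trans (sym (block-blockElem β j _)) (trans (cong (block β) eq) (block-blockElem β j' _))

blockElem-injectiveʳ : ∀ {l} (β : Vec ℕ l) j {o o'} → blockElem β j o ≡ blockElem β j o' → o ≡ o'
blockElem-injectiveʳ (b Vec.∷ β) zero    eq = ↑ˡ-injective (sum β) _ _ eq
blockElem-injectiveʳ (b Vec.∷ β) (suc j) eq = blockElem-injectiveʳ β j (↑ʳ-injective b _ _ eq)

blockElem-< : ∀ {l} (β : Vec ℕ l) j {o o'} → o <ᶠ o' → blockElem β j o <ᶠ blockElem β j o'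
blockElem-< (b Vec.∷ β) zero    {o} {o'} o<o' rewrite toℕ-↑ˡ o (sum β) | toℕ-↑ˡ o' (sum β) = o<o'
blockElem-< (b Vec.∷ β) (suc j) {o} {o'} o<o'
  rewrite toℕ-↑ʳ b (blockElem β j o) | toℕ-↑ʳ b (blockElem β j o') = +-monoʳ-< b (blockElem-< β j o<o')

block-mono : ∀ {l} (β : Vec ℕ l) {a a'} → a ≤ᶠ a' → block β a ≤ᶠ block β a'
block-mono (b Vec.∷ β) {a} {a'} a≤a' with splitAt b a in ea | splitAt b a' in ea'
... | inj₁ _ | _      = z≤n
... | inj₂ x | inj₁ y = contradiction b≤y (<⇒≱ (toℕ<n y))
  where
    b≤y : b ≤ toℕ y
    b≤y = ≤-trans (m≤m+n b (toℕ x)) (subst₂ _≤_ (toℕ-splitAt₂ ea) (toℕ-splitAt₁ ea') a≤a')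
... | inj₂ x | inj₂ y =
  s≤s (block-mono β (+-cancelˡ-≤ b _ _ (subst₂ _≤_ (toℕ-splitAt₂ ea) (toℕ-splitAt₂ ea') a≤a')))

module _ {k m : ℕ} where

  countAfter : ∀ {N} → Vec (Letter k m) N → Fin N → Letter k m → ℕ
  countAfter (_ Vec.∷ v) zero    x = countL x v
  countAfter (_ Vec.∷ v) (suc p) x = countAfter v p x

  countL-∷ : ∀ {N} x y (v : Vec (Letter k m) N) → countL x v ≤ countL x (y Vec.∷ v)
  countL-∷ x y v with x ≟L y
  ... | yes _ = n≤1+n _
  ... | no _  = ≤-refl

  countAfter<countL : ∀ {N} (v : Vec (Letter k m) N) {p x} → lookup v p ≡ x → countAfter v p x < countL x v
  countAfter<countL (y Vec.∷ v) {zero} {x} refl with x ≟L y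
  ... | yes _  = ≤-refl
  ... | no x≢y = contradiction refl x≢y
  countAfter<countL (y Vec.∷ v) {suc p} {x} vp = <-≤-trans (countAfter<countL v vp) (countL-∷ x y v)

  countAfter-decreasing : ∀ {N} (v : Vec (Letter k m) N) {p q x} → q <ᶠ p → lookup v p ≡ x →
                          countAfter v p x < countAfter v q x
  countAfter-decreasing (_ Vec.∷ v) {suc p} {zero}  _         vp = countAfter<countL v vp
  countAfter-decreasing (_ Vec.∷ v) {suc p} {suc q} (s≤s q<p) vp = countAfter-decreasing v q<p vp

  countAfter-injective : ∀ {N} (v : Vec (Letter k m) N) {p q x} → lookup v p ≡ x → lookup v q ≡ x →
                         countAfter v p x ≡ countAfter v q x → p ≡ q
  countAfter-injective v {p} {q} vp vq same with <-cmp (toℕ p) (toℕ q)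
  ... | tri≈ _ p≡q _ = toℕ-injective p≡q
  ... | tri< p<q _ _ = contradiction (sym same) (<⇒≢ (countAfter-decreasing v p<q vq))
  ... | tri> _ _ q<p = contradiction same (<⇒≢ (countAfter-decreasing v q<p vp))

  countL≡0 : ∀ {N} (v : Vec (Letter k m) N) {x} → (∀ p → lookup v p ≢ x) → countL x v ≡ 0
  countL≡0 Vec.[]      _          = refl
  countL≡0 (y Vec.∷ v) {x} absent with x ≟L y
  ... | yes x≡y = contradiction (sym x≡y) (absent zero)
  ... | no _    = countL≡0 v (absent ∘ suc)

  countL≤1 : ∀ {N} (v : Vec (Letter k m) N) {x} →
             (∀ {p q} → lookup v p ≡ x → lookup v q ≡ x → p ≡ q) → countL x v ≤ 1
  countL≤1 Vec.[]      _        = z≤n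
  countL≤1 (y Vec.∷ v) {x} once with x ≟L y
  ... | yes x≡y = s≤s (≤-reflexive (countL≡0 v λ p vp → Finₚ.0≢1+n (once (sym x≡y) vp)))
  ... | no _    = countL≤1 v λ vp vq → Finₚ.suc-injective (once vp vq)

u-rank-mono : ∀ {k l} (A : Shuffle k l) {i j} → i ≤ᶠ j → rank A (u i) ≤ rank A (u j)
u-rank-mono A {i} {j} i≤j with m≤n⇒m<n∨m≡n i≤j
... | inj₁ i<j = <⇒≤ (u-increasing A i j i<j)
... | inj₂ i≡j = ≤-reflexive (cong (rank A ∘ u) (toℕ-injective i≡j))

module Standardisation {k l n : ℕ} (v : Word k l n) (β : Vec ℕ l)
                       (counts : ∀ j → countL (u j) v ≡ lookup β j) where

  S M : ℕ
  S = sum β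
  M = suc S

  offset : ∀ {p j} → lookup v p ≡ u j → Fin (lookup β j)
  offset {p} {j} vp = fromℕ< (subst (countAfter v p (u j) <_) (counts j) (countAfter<countL v vp))

  -- The occurrence of u_j at position p becomes the element of block j numbered by the
  -- occurrences of u_j after p.  Since fromℕ< ignores its proof, only p and j matter.
  standardise : ∀ p x → lookup v p ≡ x → Letter k S
  standardise p (t a) _  = t a
  standardise p (u j) vp = u (blockElem β j (offset vp))

  w : Word k S n
  w = tabulate λ p → standardise p (lookup v p) refl

  collapse : Letter k S → Letter k l
  collapse (t a) = t a
  collapse (u b) = u (block β b)

  tag : Letter k S → ℕ
  tag (t _) = 0
  tag (u b) = suc (toℕ b)

  tag<M : ∀ x → tag x < M
  tag<M (t _) = s≤s z≤n
  tag<M (u b) = s≤s (toℕ<n b)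

  collapse-tag-injective : ∀ {x y} → collapse x ≡ collapse y → tag x ≡ tag y → x ≡ y
  collapse-tag-injective {t a} {t b} refl _    = refl
  collapse-tag-injective {u a} {u b} _    same = cong u (toℕ-injective (suc-injective same))

  shuffle : Shuffle k l → Shuffle k S
  shuffle A = record
    { rank           = rank'
    ; rank-injective = λ x y same → let c , d = lex-injective (tag<M x) (tag<M y) same
                                    in collapse-tag-injective (rank-injective A _ _ c) d
    ; t-increasing   = λ i j i<j → lex-< (s≤s z≤n) (t-increasing A i j i<j)
    ; u-increasing   = λ a b a<b →
        +-mono-≤-< (*-monoˡ-≤ M (u-rank-mono A (block-mono β (<⇒≤ a<b)))) (s≤s a<b)
    }
    where
      rank' : Letter k S → ℕ
      rank' x = rank A (collapse x) * M + tag x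

  lookup-w : ∀ p → lookup w p ≡ standardise p (lookup v p) refl
  lookup-w p = lookup∘tabulate _ p

  collapse-w : ∀ p → collapse (lookup w p) ≡ lookup v p
  collapse-w p = trans (cong collapse (lookup-w p)) (collapse-standardise (lookup v p) refl)
    where
      collapse-standardise : ∀ x (vp : lookup v p ≡ x) → collapse (standardise p x vp) ≡ x
      collapse-standardise (t a) _ = refl
      collapse-standardise (u j) _ = cong u (block-blockElem β j _)

  sameKind-w : ∀ p → SameKind (lookup v p) (lookup w p)
  sameKind-w p = subst (SameKind (lookup v p)) (sym (lookup-w p)) (sameKind-standardise (lookup v p) refl)
    where
      sameKind-standardise : ∀ x (vp : lookup v p ≡ x) → SameKind x (standardise p x vp)
      sameKind-standardise (t _) _ = t~t
      sameKind-standardise (u _) _ = u~u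

  w-t : ∀ {p a} → t a ≡ lookup v p → lookup w p ≡ t a
  w-t {p} vp = trans (lookup-w p) (standardise-t (lookup v p) refl vp)
    where
      standardise-t : ∀ {a} x (vp : lookup v p ≡ x) → t a ≡ x → standardise p x vp ≡ t a
      standardise-t _ _ refl = refl

  w-u : ∀ {p j} (vp : u j ≡ lookup v p) → lookup w p ≡ u (blockElem β j (offset (sym vp)))
  w-u {p} vp = trans (lookup-w p) (standardise-u (lookup v p) refl vp)
    where
      standardise-u : ∀ {j} x (vp : lookup v p ≡ x) (x≡ : u j ≡ x) →
                      standardise p x vp ≡ u (blockElem β j (offset (trans vp (sym x≡))))
      standardise-u _ _ refl = refl

  w-u⁻¹ : ∀ {p b} → lookup w p ≡ u b →
          ∃[ j ] Σ (u j ≡ lookup v p) λ vp → b ≡ blockElem β j (offset (sym vp))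
  w-u⁻¹ {p} wp = standardise-u⁻¹ (lookup v p) refl (trans (sym (lookup-w p)) wp)
    where
      standardise-u⁻¹ : ∀ {b} x (vp : lookup v p ≡ x) → standardise p x vp ≡ u b →
                        ∃[ j ] Σ (u j ≡ x) λ x≡ → b ≡ blockElem β j (offset (trans vp (sym x≡)))
      standardise-u⁻¹ (u j) _ refl = j , refl , refl

  offset-toℕ : ∀ {p j} (vp : lookup v p ≡ u j) → toℕ (offset vp) ≡ countAfter v p (u j)
  offset-toℕ _ = toℕ-fromℕ< _

  w-u-injective : ∀ {b p q} → lookup w p ≡ u b → lookup w q ≡ u b → p ≡ q
  w-u-injective wp wq with w-u⁻¹ wp | w-u⁻¹ wq
  ... | j , vp , refl | j' , vq , b≡ with refl ← blockElem-injectiveˡ β b≡ =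
    countAfter-injective v (sym vp) (sym vq) (begin
      countAfter v _ (u j)   ≡⟨ offset-toℕ (sym vp) ⟨
      toℕ (offset (sym vp)) ≡⟨ cong toℕ (blockElem-injectiveʳ β j b≡) ⟩
      toℕ (offset (sym vq)) ≡⟨ offset-toℕ (sym vq) ⟩
      countAfter v _ (u j)   ∎)
    where open ≡-Reasoning

  rank-w : ∀ (A : Shuffle k l) {p x} → x ≡ lookup v p →
           rank (shuffle A) (lookup w p) ≡ rank A x * M + tag (lookup w p)
  rank-w A {p} vp = cong (λ y → rank A y * M + tag (lookup w p)) (trans (collapse-w p) (sym vp))

  tag-later : ∀ {p q a} → u a ≡ lookup v p → u a ≡ lookup v q → q <ᶠ p →
              tag (lookup w p) < tag (lookup w q)
  tag-later {a = a} vp vq q<p = subst₂ (λ x y → tag x < tag y) (sym (w-u vp)) (sym (w-u vq))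
    (s≤s (blockElem-< β a (subst₂ _<_ (sym (offset-toℕ (sym vp))) (sym (offset-toℕ (sym vq)))
                                      (countAfter-decreasing v q<p (sym vp)))))

  compatible : (A : Shuffle k l) → Compatible v A w (shuffle A)
  compatible A = record { sameKind = sameKind-w ; rowAgree = rowAgree ; colAgree = colAgree }
    where
      A' = shuffle A

      rowAgree : ∀ {a p} q → t a ≡ lookup v p →
                 rank A (t a) < rank A (lookup v q) ⇔ rank A' (lookup w p) < rank A' (lookup w q)
      rowAgree {a} {p} q vp = mk⇔ to from
        where
          rank-p : rank A' (lookup w p) ≡ rank A (t a) * M + 0
          rank-p = cong (rank A') (w-t vp)

          to : rank A (t a) < rank A (lookup v q) → rank A' (lookup w p) < rank A' (lookup w q)
          to lt = subst₂ _<_ (sym rank-p) (sym (rank-w A refl)) (lex-< (s≤s z≤n) lt)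

          from : rank A' (lookup w p) < rank A' (lookup w q) → rank A (t a) < rank A (lookup v q)
          from lt with lex-<⁻¹ (tag<M (lookup w q)) (subst₂ _<_ rank-p (rank-w A refl) lt)
          ... | inj₁ lt'            = lt'
          ... | inj₂ (same , 0<tag) =
                contradiction (subst (λ x → 0 < tag x) (w-t (rank-injective A _ _ same)) 0<tag) λ ()

      colAgree : ∀ {a p} q → u a ≡ lookup v p → (lookup v q ≡ u a → q <ᶠ p) →
                 rank A (u a) ≤ rank A (lookup v q) ⇔ rank A' (lookup w p) ≤ rank A' (lookup w q)
      colAgree {a} {p} q vp earlier = mk⇔ to from
        where
          to : rank A (u a) ≤ rank A (lookup v q) → rank A' (lookup w p) ≤ rank A' (lookup w q)
          to le with m≤n⇒m<n∨m≡n le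
          ... | inj₁ lt   = <⇒≤ (subst₂ _<_ (sym (rank-w A vp)) (sym (rank-w A refl)) (lex-< (tag<M _) lt))
          ... | inj₂ same with vq ← rank-injective A _ _ same =
                subst₂ _≤_ (sym (rank-w A vp)) (sym (rank-w A vq))
                  (+-monoʳ-≤ (rank A (u a) * M) (<⇒≤ (tag-later vp vq (earlier (sym vq)))))

          from : rank A' (lookup w p) ≤ rank A' (lookup w q) → rank A (u a) ≤ rank A (lookup v q)
          from le = ≮⇒≥ λ lt →
            ≤⇒≯ le (subst₂ _<_ (sym (rank-w A refl)) (sym (rank-w A vp)) (lex-< (tag<M _) lt))

shape-relabel : ∀ {k m m' n} (w : Word k m' n) (P : Tableau k m n) → shape (relabel w P) ≡ shape P
shape-relabel w P = trans (sym (map-∘ P)) (map-cong (length-map _) P)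

lemma3p3 : ∀ {k l n} (v : Word k l n) (α : Vec ℕ k) (β : Vec ℕ l) →
    HasType v α β →
    Σ (Word k (sum β) n) λ w →
      ((j : Fin (sum β)) → countL (u j) w ≤ 1) ×
      ((A : Shuffle k l) → Σ (Shuffle k (sum β)) λ A' →
        Σ (Tableau k l n) (λ Pv → InsTab A v Pv) ×
        Σ (Tableau k (sum β) n) (λ Pw → InsTab A' w Pw) ×
        ((Pv : Tableau k l n) (Pw : Tableau k (sum β) n) →
          InsTab A v Pv → InsTab A' w Pw →
          (Pw ≡ relabel w Pv) × (shape Pw ≡ shape Pv)))
lemma3p3 v α β (_ , counts) = w , (λ b → countL≤1 w (w-u-injective {b})) , λ A →
  let open Lockstep (compatible A)
      Pv , insV = Invariants.insTab-exists A v
  in shuffle A , (Pv , insV) , (relabel w Pv , insTab-relabel insV) ,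
     λ Pv' Pw insV' insW → let Pw≡ = run-deterministic (shuffle A) insW (insTab-relabel insV')
                           in Pw≡ , trans (cong shape Pw≡) (shape-relabel w Pv')
  where open Standardisation v β counts
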